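{- Let $G$ be a cubic graph of girth at least $7$, and let $P$ be a geodesic in $G$. Then $N(P)$, the set of vertices not on $P$ that are adjacent to some vertex of $P$, is an independent set in $G$.
   Context: Graphs are finite and simple; cubic means every vertex has degree $3$. A geodesic is a shortest path in $G$ between its two endpoints. -}

module Defs where

open import Data.Nat using (ℕ; _≤_)
open import Data.Bool using (Bool; true; false)
open import Data.Fin using (Fin)
open import Data.List using (List; []; _∷_; length; filterᵇ; allFin; head; last; _∷ʳ_)
open import Data.List.Relation.Unary.Linked using (Linked)
open import Data.List.Relation.Unary.Unique.Propositional using (Unique)
open import Data.List.Membership.Propositional using (_∈_; _∉_)
open import Data.Product using (_×_; ∃-syntax)
open import Data.Empty using (⊥)
open import Relation.Nullary using (¬_)
open import Relation.Binary.PropositionalEquality using (_≡_)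

record Graph (n : ℕ) : Set where
  field
    adj   : Fin n → Fin n → Bool
    irrefl : ∀ v → adj v v ≡ false
    sym   : ∀ u v → adj u v ≡ adj v u
open Graph public

module _ {n : ℕ} (G : Graph n) where

  Adj : Fin n → Fin n → Set
  Adj u v = adj G u v ≡ true

  degree : Fin n → ℕ
  degree v = length (filterᵇ (adj G v) (allFin n))

  Cubic : Set
  Cubic = ∀ v → degree v ≡ 3

  IsPath : List (Fin n) → Set
  IsPath []       = ⊥
  IsPath (v ∷ vs) = Linked Adj (v ∷ vs) × Unique (v ∷ vs)

  IsCycle : List (Fin n) → Set
  IsCycle []       = ⊥
  IsCycle (v ∷ vs) = Unique (v ∷ vs) × 3 ≤ length (v ∷ vs) × Linked Adj ((v ∷ vs) ∷ʳ v)

  GirthAtLeast : ℕ → Set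
  GirthAtLeast g = ∀ c → IsCycle c → g ≤ length c

  IsGeodesic : List (Fin n) → Set
  IsGeodesic p = IsPath p ×
    (∀ q → IsPath q → head q ≡ head p → last q ≡ last p → length p ≤ length q)

  InNbhd : List (Fin n) → Fin n → Set
  InNbhd p w = w ∉ p × ∃[ u ] (u ∈ p × Adj u w)

  Independent : (Fin n → Set) → Set
  Independent S = ∀ u v → S u → S v → ¬ Adj u v

-- Suppose x, y ∈ N(P) are adjacent, with neighbours u, v on P.  If u = v then u x y is a
-- triangle.  Otherwise, replacing the segment of P from u to v by the detour u x y v gives a
-- path with the same endpoints, so by minimality of P that segment has at most three edges;
-- closing it up through v y x u yields a cycle of length at most 6, against girth ≥ 7.
module Submission where

open import Defs hiding (sym)
open import Data.Nat using (ℕ; _≤_; s≤s; s≤s⁻¹; z≤n; suc; _+_)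
open import Data.Nat.Properties
  using (+-cancelˡ-≤; +-cancelʳ-≤; +-monoˡ-≤; ≤-trans; ≤-reflexive; ≤⇒≯)
open import Data.Fin using (Fin; _≟_)
open import Data.List using (List; []; _∷_; _++_; [_]; _∷ʳ_; length; head; last)
open import Data.List.Properties using (++-assoc; length-++)
open import Data.List.Relation.Unary.Linked as Linked using (Linked; [-]; _∷_)
open import Data.List.Relation.Unary.AllPairs using (AllPairs; []; _∷_)
open import Data.List.Relation.Unary.All using ([]; _∷_)
open import Data.List.Relation.Unary.All.Properties using (¬Any⇒All¬)
open import Data.List.Relation.Unary.Any using (here; there)
open import Data.List.Relation.Unary.Unique.Propositional using (Unique)
import Data.List.Relation.Unary.Unique.Propositional.Properties as Unique
open import Data.List.Membership.Propositional using (_∈_; _∉_)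
open import Data.List.Membership.Propositional.Properties using (∈-∃++)
open import Data.List.Relation.Binary.Disjoint.Propositional using (Disjoint)
open import Data.List.Relation.Binary.Sublist.Propositional as Sublist
  using (_⊆_; _⊇_; []; _∷_; ⊆-refl; minimum)
open import Data.List.Relation.Binary.Sublist.Propositional.Properties
  using (All-resp-⊆; Any-resp-⊆; ++⁺ˡ; ++⁺)
open import Data.List.Relation.Binary.Permutation.Propositional using (_↭_; ↭-sym; ↭-trans; ↭⇒↭ₛ)
open import Data.List.Relation.Binary.Permutation.Propositional.Properties using (shift; shifts)
  renaming (++⁺ˡ to ↭-++⁺ˡ)
import Data.List.Relation.Binary.Permutation.Setoid.Properties as PermutationSetoid
open import Data.Product using (_,_; proj₁; proj₂)
open import Data.Sum using (_⊎_; inj₁; inj₂)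
open import Data.Empty using (⊥-elim)
open import Function using (_∘_)
open import Relation.Binary.Core using (Rel)
open import Relation.Binary.Definitions using (_Respects_)
open import Relation.Binary.PropositionalEquality
  using (_≡_; _≢_; refl; sym; trans; subst; subst₂; cong; setoid)
open import Relation.Nullary using (¬_; yes; no)

module _ {A : Set} where

  data Splits (u v : A) : List A → Set where
    splits : ∀ xs ms ys → Splits u v (xs ++ u ∷ ms ++ v ∷ ys)

  ∈-splits : ∀ {u v xs} → u ∈ xs → v ∈ xs → u ≢ v → Splits u v xs ⊎ Splits v u xs
  ∈-splits (here refl) (here refl) u≢v = ⊥-elim (u≢v refl)
  ∈-splits (here refl) (there v∈xs) _ with ∈-∃++ v∈xs
  ... | ms , ys , refl = inj₁ (splits [] ms ys)
  ∈-splits (there u∈xs) (here refl) _ with ∈-∃++ u∈xs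
  ... | ms , ys , refl = inj₂ (splits [] ms ys)
  ∈-splits {xs = x ∷ _} (there u∈xs) (there v∈xs) u≢v with ∈-splits u∈xs v∈xs u≢v
  ... | inj₁ (splits xs ms ys) = inj₁ (splits (x ∷ xs) ms ys)
  ... | inj₂ (splits xs ms ys) = inj₂ (splits (x ∷ xs) ms ys)

  head-++-∷ : ∀ (xs : List A) {y ys zs} → head (xs ++ y ∷ ys) ≡ head (xs ++ y ∷ zs)
  head-++-∷ []      = refl
  head-++-∷ (_ ∷ _) = refl

  last-++-∷ : ∀ (xs : List A) {y ys} → last (xs ++ y ∷ ys) ≡ last (y ∷ ys)
  last-++-∷ []           = refl
  last-++-∷ (_ ∷ [])     = refl
  last-++-∷ (_ ∷ x ∷ xs) = last-++-∷ (x ∷ xs)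

  module _ {ℓ} {R : Rel A ℓ} where

    Linked-suffix : ∀ xs {y ys} → Linked R (xs ++ y ∷ ys) → Linked R (y ∷ ys)
    Linked-suffix []       l = l
    Linked-suffix (_ ∷ xs) l = Linked-suffix xs (Linked.tail l)

    Linked-graft : ∀ xs {y ys zs} → Linked R (xs ++ y ∷ ys) → Linked R (y ∷ zs) →
      Linked R (xs ++ y ∷ zs)
    Linked-graft []           _       l′ = l′
    Linked-graft (_ ∷ [])     (r ∷ _) l′ = r ∷ l′
    Linked-graft (_ ∷ x ∷ xs) (r ∷ l) l′ = r ∷ Linked-graft (x ∷ xs) l l′

    AllPairs-resp-⊇ : AllPairs R Respects _⊇_
    AllPairs-resp-⊇ []                []       = []
    AllPairs-resp-⊇ (_ Sublist.∷ʳ τ) (_ ∷ rs) = AllPairs-resp-⊇ τ rs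
    AllPairs-resp-⊇ (refl ∷ τ)        (r ∷ rs) = All-resp-⊆ τ r ∷ AllPairs-resp-⊇ τ rs

  Unique-resp-↭ : Unique Respects _↭_
  Unique-resp-↭ = PermutationSetoid.Unique-resp-↭ (setoid A) ∘ ↭⇒↭ₛ

  Unique-replace : ∀ xs {y ms ns ys} → Unique (xs ++ y ∷ ms ++ ys) → Unique ns →
    Disjoint ns (xs ++ y ∷ ms ++ ys) → Unique (xs ++ y ∷ ns ++ ys)
  Unique-replace xs {y} {ms} {ns} {ys} old! ns! ns#old =
    Unique-resp-↭ (↭-sym ns-to-front) (Unique.++⁺ ns! rest! ns#rest)
    where
    ns-to-front : xs ++ y ∷ ns ++ ys ↭ ns ++ xs ++ y ∷ ys
    ns-to-front = ↭-trans (↭-++⁺ˡ xs (↭-sym (shift y ns ys))) (shifts xs ns)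
    rest⊆old : xs ++ y ∷ ys ⊆ xs ++ y ∷ ms ++ ys
    rest⊆old = ++⁺ ⊆-refl (refl ∷ ++⁺ˡ ms ⊆-refl)
    rest! : Unique (xs ++ y ∷ ys)
    rest! = AllPairs-resp-⊇ rest⊆old old!
    ns#rest : Disjoint ns (xs ++ y ∷ ys)
    ns#rest (w∈ns , w∈rest) = ns#old (w∈ns , Any-resp-⊆ rest⊆old w∈rest)

module _ {n : ℕ} (G : Graph n) where

  Adj-sym : ∀ {u v} → Adj G u v → Adj G v u
  Adj-sym {u} {v} u~v = trans (Graph.sym G v u) u~v

  Adj⇒≢ : ∀ {u v} → Adj G u v → u ≢ v
  Adj⇒≢ {u} u~u refl with trans (sym u~u) (Graph.irrefl G u)
  ... | ()

  IsPath⇒Linked : ∀ {p} → IsPath G p → Linked (Adj G) p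
  IsPath⇒Linked {_ ∷ _} = proj₁

  IsPath⇒Unique : ∀ {p} → IsPath G p → Unique p
  IsPath⇒Unique {_ ∷ _} = proj₂

  IsPath⁺ : ∀ xs {y ys} → Linked (Adj G) (xs ++ y ∷ ys) → Unique (xs ++ y ∷ ys) →
    IsPath G (xs ++ y ∷ ys)
  IsPath⁺ []      = _,_
  IsPath⁺ (_ ∷ _) = _,_

  geodesic-segment-minimal : ∀ A {u M v B D} → IsGeodesic G (A ++ u ∷ M ++ v ∷ B) →
    Linked (Adj G) (u ∷ D ++ [ v ]) → Unique D → Disjoint D (A ++ u ∷ M ++ v ∷ B) →
    length M ≤ length D
  geodesic-segment-minimal A {u} {M} {v} {B} {D} (path , shortest) detour D! D#P =
    +-cancelʳ-≤ (length (v ∷ B)) _ _ (s≤s⁻¹ (+-cancelˡ-≤ (length A) _ _ P≤Q))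
    where
    via : List (Fin n) → List (Fin n)
    via ms = A ++ u ∷ ms ++ v ∷ B
    length-via : ∀ ms → length (via ms) ≡ length A + suc (length ms + length (v ∷ B))
    length-via ms = trans (length-++ A) (cong (λ k → length A + suc k) (length-++ ms))
    last-via : ∀ ms → last (via ms) ≡ last (v ∷ B)
    last-via ms = trans (last-++-∷ A) (last-++-∷ (u ∷ ms))
    Q-path : IsPath G (via D)
    Q-path = IsPath⁺ A
      (Linked-graft A P-linked (Linked-graft (u ∷ D) detour (Linked-suffix (u ∷ M) (Linked-suffix A P-linked))))
      (Unique-replace A (IsPath⇒Unique path) D! D#P)
      where P-linked = IsPath⇒Linked path
    P≤Q : length A + suc (length M + length (v ∷ B)) ≤ length A + suc (length D + length (v ∷ B))
    P≤Q = subst₂ _≤_ (length-via M) (length-via D)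
      (shortest (via D) Q-path (head-++-∷ A) (trans (last-via D) (sym (last-via M))))

  cycle-through-fresh-edge : ∀ {s ss x y} → Unique (s ∷ ss) → Linked (Adj G) ((s ∷ ss) ∷ʳ y) →
    Adj G y x → Adj G x s → x ∉ s ∷ ss → y ∉ s ∷ ss → IsCycle G (y ∷ x ∷ s ∷ ss)
  cycle-through-fresh-edge {s} {ss} path! path-y y~x x~s x∉ y∉ =
    ((Adj⇒≢ y~x ∷ ¬Any⇒All¬ (s ∷ ss) y∉) ∷ ¬Any⇒All¬ (s ∷ ss) x∉ ∷ path!) ,
    s≤s (s≤s (s≤s z≤n)) ,
    y~x ∷ x~s ∷ path-y

  module _ (girth : GirthAtLeast G 7) where

    no-cycle-of-length≤6 : ∀ {c} → IsCycle G c → ¬ length c ≤ 6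
    no-cycle-of-length≤6 {c} cycle c≤6 = ≤⇒≯ c≤6 (girth c cycle)

    segment-neighbours-nonadjacent : ∀ A M B {u v x y} → IsGeodesic G (A ++ u ∷ M ++ v ∷ B) →
      x ∉ A ++ u ∷ M ++ v ∷ B → y ∉ A ++ u ∷ M ++ v ∷ B →
      Adj G u x → Adj G v y → ¬ Adj G x y
    segment-neighbours-nonadjacent A M B {u} {v} {x} {y} geo@(path , _) x∉P y∉P u~x v~y x~y =
      no-cycle-of-length≤6 cycle cycle≤6
      where
      xy#P : Disjoint (x ∷ y ∷ []) (A ++ u ∷ M ++ v ∷ B)
      xy#P (here refl         , x∈P) = x∉P x∈P
      xy#P (there (here refl) , y∈P) = y∉P y∈P
      M≤2 : length M ≤ 2
      M≤2 = geodesic-segment-minimal A geo (u~x ∷ x~y ∷ Adj-sym v~y ∷ [-])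
        ((Adj⇒≢ x~y ∷ []) ∷ [] ∷ []) xy#P
      segment⊆P : u ∷ M ++ [ v ] ⊆ A ++ u ∷ M ++ v ∷ B
      segment⊆P = ++⁺ˡ A (refl ∷ ++⁺ ⊆-refl (refl ∷ minimum B))
      segment-y : Linked (Adj G) ((u ∷ M ++ [ v ]) ∷ʳ y)
      segment-y = subst (λ ms → Linked (Adj G) (u ∷ ms)) (sym (++-assoc M [ v ] [ y ]))
        (Linked-graft (u ∷ M) (Linked-suffix A (IsPath⇒Linked path)) (v~y ∷ [-]))
      cycle : IsCycle G (y ∷ x ∷ u ∷ M ++ [ v ])
      cycle = cycle-through-fresh-edge (AllPairs-resp-⊇ segment⊆P (IsPath⇒Unique path)) segment-y
        (Adj-sym x~y) (Adj-sym u~x) (x∉P ∘ Any-resp-⊆ segment⊆P) (y∉P ∘ Any-resp-⊆ segment⊆P)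
      cycle≤6 : length (y ∷ x ∷ u ∷ M ++ [ v ]) ≤ 6
      cycle≤6 = s≤s (s≤s (s≤s (≤-trans (≤-reflexive (length-++ M)) (+-monoˡ-≤ 1 M≤2))))

lemma3p1 : (n : ℕ) (G : Graph n) → Cubic G → GirthAtLeast G 7 →
    (P : List (Fin n)) → IsGeodesic G P → Independent G (InNbhd G P)
lemma3p1 n G _ girth P geo x y (x∉P , u , u∈P , u~x) (y∉P , v , v∈P , v~y) x~y with u ≟ v
... | yes refl = no-cycle-of-length≤6 G girth triangle (s≤s (s≤s (s≤s z≤n)))
  where
  triangle : IsCycle G (y ∷ x ∷ u ∷ [])
  triangle = cycle-through-fresh-edge G ([] ∷ []) (v~y ∷ [-]) (Adj-sym G x~y) (Adj-sym G u~x)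
    (λ { (here refl) → x∉P u∈P }) (λ { (here refl) → y∉P u∈P })
... | no u≢v with ∈-splits u∈P v∈P u≢v
...   | inj₁ (splits A M B) = segment-neighbours-nonadjacent G girth A M B geo x∉P y∉P u~x v~y x~y
...   | inj₂ (splits A M B) = segment-neighbours-nonadjacent G girth A M B geo y∉P x∉P v~y u~x (Adj-sym G x~y)
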